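{- Let $\pi=a_1a_2\cdots a_n$ be a permutation of $[n]$ with permutation matrix $M_0$. Run any tile merging algorithm on $M_0$. Then every square unitary tile $T$ that appears during the computation is good: if $T$ has size $k$ and occupies the set of rows $R$ and the set of columns $C$, then the $k\times k$ submatrix of $M_0$ with rows $R$ and columns $C$ contains exactly $k$ entries equal to $1$ (so it is a permutation matrix of a permutation of $[k]$), and that permutation of $[k]$ is full.
   Context: $[n]=\{1,\dots,n\}$. A permutation $\pi=a_1\cdots a_n$ of $[n]$ is written in one-line notation ($a_i=\pi(i)$); its permutation matrix $M_0$ is the $n\times n$ matrix with a $1$ in row $n+1-a_j$, column $j$, for each $j$, and $0$ elsewhere. Bootstrap percolation: a cell is mutable if it contains $0$ and at least two of its orthogonal neighbours (N, S, E, W) contain $1$; a step changes one mutable cell to $1$; complete percolation continues until no mutable cell remains, and the final configuration is independent of the order of steps. A permutation $\sigma$ of $[k]$ is full if the final configuration of bootstrap percolation on its permutation matrix is the all-ones $k\times k$ matrix. A tile is a rectangular block of consecutive rows and columns; unitary if all entries are $1$; square of size $k$ if $k\times k$. Tile merging algorithm: start from $M_0$, viewed as $n$ square unitary tiles of size $1$. Two square unitary tiles occupying row sets $R_1,R_2$ and column sets $C_1,C_2$ are diagonally adjacent if $C_2$ immediately follows $C_1$ (or vice versa) and $R_2$ immediately follows or precedes $R_1$, so the tiles touch at a corner; merging them sets every cell in rows $R_1\cup R_2$ and columns $C_1\cup C_2$ to $1$, producing a square unitary tile of size $|R_1|+|R_2|$. The algorithm repeatedly merges some diagonally adjacent pair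 of current square unitary tiles (in some specified order) until no such pair exists. -}

module Defs where

open import Data.Bool.Base using (Bool; true; false; if_then_else_; _∧_)
open import Data.Nat.Base using (ℕ; zero; suc; _+_; _≤_; _<_; _≡ᵇ_; _<ᵇ_; _⊓_)
open import Data.Fin.Base using (Fin; toℕ; fromℕ<)
open import Data.Fin.Permutation using (Permutation′; _⟨$⟩ʳ_)
open import Data.List.Base using (List; []; _∷_; map)
open import Data.Nat.ListAction using (sum)
open import Data.List.Relation.Binary.Permutation.Propositional using (_↭_)
open import Data.List.Membership.Propositional using (_∈_)
open import Data.List using (allFin)
open import Data.Product.Base using (Σ; _×_; ∃; ∃-syntax)
open import Data.Sum.Base using (_⊎_)
open import Relation.Binary.PropositionalEquality using (_≡_)
open import Relation.Binary.Construct.Closure.ReflexiveTransitive using (Star)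
open import Relation.Nullary.Decidable using (yes; no)
open import Data.Nat.Properties using (_<?_)

-- 0/1 matrices.  A k×k matrix is a function Fin k → Fin k → Bool,
-- first argument = row (0-based, top to bottom), second = column
-- (0-based, left to right); true = 1, false = 0.

Matrix : ℕ → Set
Matrix k = Fin k → Fin k → Bool

-- Read an entry at natural-number coordinates; out of range = 0.
at : ∀ {k} → Matrix k → ℕ → ℕ → Bool
at {k} M i j with i <? k | j <? k
... | yes i<k | yes j<k = M (fromℕ< i<k) (fromℕ< j<k)
... | _       | _       = false

-- Permutation matrix of σ (one-line notation a_j = σ(j)):
-- a 1 in row k+1-a_j, column j (1-based).  With 0-based indices
-- (row r, column c, value σ c ∈ {0..k-1}) this is r + σ(c) + 1 = k.
permMatrix : ∀ {k} → Permutation′ k → Matrix k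
permMatrix {k} σ r c = (toℕ r + toℕ (σ ⟨$⟩ʳ c) + 1) ≡ᵇ k

b2n : Bool → ℕ
b2n true  = 1
b2n false = 0

neighbours1 : ∀ {k} → Matrix k → Fin k → Fin k → ℕ
neighbours1 M i j =
  north (toℕ i) + b2n (at M (suc (toℕ i)) (toℕ j))
  + west (toℕ j) + b2n (at M (toℕ i) (suc (toℕ j)))
  where
  north : ℕ → ℕ
  north zero    = 0
  north (suc r) = b2n (at M r (toℕ j))
  west : ℕ → ℕ
  west zero    = 0
  west (suc c) = b2n (at M (toℕ i) c)

Mutable : ∀ {k} → Matrix k → Fin k → Fin k → Set
Mutable M i j = (M i j ≡ false) × (2 ≤ neighbours1 M i j)

PercStep : ∀ {k} → Matrix k → Matrix k → Set
PercStep {k} M M′ =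
  ∃[ i ] ∃[ j ] (Mutable M i j ×
    (∀ (i′ j′ : Fin k) →
       M′ i′ j′ ≡ (if ((toℕ i′ ≡ᵇ toℕ i) ∧ (toℕ j′ ≡ᵇ toℕ j)) then true else M i′ j′)))

-- σ is full: bootstrap percolation on its permutation matrix reaches the
-- all-ones matrix (the final configuration being order-independent,
-- this is the same as the final configuration being all ones).
Full : ∀ {k} → Permutation′ k → Set
Full {k} σ = ∃[ M ] (Star PercStep (permMatrix σ) M × (∀ i j → M i j ≡ true))

-- Tiles: rows row, …, row+size-1 and columns col, …, col+size-1
-- (0-based) of the n×n matrix.  All tiles considered are square.

record Tile : Set where
  constructor tile
  field
    row  : ℕ
    col  : ℕ
    size : ℕ
open Tile public

-- The initial tiles: one size-1 tile on each 1 of M_0 = permMatrix π,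
-- i.e. at row n-1-π(j), column j (0-based).
initialTile : ∀ {n} → Permutation′ n → Fin n → Tile
initialTile {suc n} π j = tile (n Data.Nat.Base.∸ toℕ (π ⟨$⟩ʳ j)) (toℕ j) 1

initialTiles : ∀ {n} → Permutation′ n → List Tile
initialTiles {n} π = map (initialTile π) (allFin n)

-- T₂'s columns immediately follow T₁'s, and T₂'s rows immediately follow
-- or precede T₁'s (the "vice versa" case of columns is covered because
-- the merge step below may pick the two tiles in either order).
DiagAdj : Tile → Tile → Set
DiagAdj T₁ T₂ =
  (col T₂ ≡ col T₁ + size T₁) ×
  ((row T₂ ≡ row T₁ + size T₁) ⊎ (row T₁ ≡ row T₂ + size T₂))

merge : Tile → Tile → Tile
merge T₁ T₂ = tile (row T₁ ⊓ row T₂) (col T₁ ⊓ col T₂) (size T₁ + size T₂)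

MergeStep : List Tile → List Tile → Set
MergeStep ts ts′ =
  ∃[ T₁ ] ∃[ T₂ ] ∃[ rest ]
    ((ts ↭ (T₁ ∷ T₂ ∷ rest)) × DiagAdj T₁ T₂ × (ts′ ≡ merge T₁ T₂ ∷ rest))

subMatrix : ∀ {n} → Permutation′ n → (T : Tile) → Matrix (size T)
subMatrix π T i j = at (permMatrix π) (row T + toℕ i) (col T + toℕ j)

countOnes : ∀ {k} → Matrix k → ℕ
countOnes {k} M = sum (map (λ i → sum (map (λ j → b2n (M i j)) (allFin k))) (allFin k))

Good : ∀ {n} → Permutation′ n → Tile → Set
Good π T =
  (countOnes (subMatrix π T) ≡ size T) ×
  Σ (Permutation′ (size T)) (λ σ →
     (∀ i j → permMatrix σ i j ≡ subMatrix π T i j) × Full σ)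

-- Every tile T that occurs percolates in its own square: bootstrap percolation
-- started from the ones of M₀ inside T fills T.  A tile of size 1 is a single one
-- of M₀.  When two percolating tiles merge, each of the two rectangles of the new
-- square outside them is bordered by a full edge row of one tile and a full edge
-- column of the other, so it fills row by row.  This filling only ever occupies a
-- cell from a vertical and a horizontal neighbour, so it cannot enter a row or a
-- column without ones: a percolating tile has a one in every row and column.  As
-- M₀ has at most one per row and column, the ones of T form a permutation matrix,
-- and percolation on it is full.

{-# OPTIONS --safe #-}
module Submission where

open import Defs
open import Data.Bool.Base using (Bool; true; false; if_then_else_; _∧_)
open import Data.Bool.Properties using (T-≡; ⇔→≡; ¬-not)
open import Data.Fin.Base using (Fin; zero; suc; toℕ; fromℕ<; opposite)
open import Data.Fin.Properties
  using (toℕ<n; toℕ-fromℕ<; fromℕ<-toℕ; toℕ-injective; opposite-prop; opposite-involutive)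
import Data.Fin.Properties as Finₚ
open import Data.Fin.Permutation using (Permutation′; _⟨$⟩ʳ_; _⟨$⟩ˡ_; inverseˡ; permutation)
open import Data.List.Base using (List; []; _∷_; map; tabulate; cartesianProduct)
open import Data.List using (allFin)
open import Data.List.Properties using (map-tabulate)
open import Data.List.Membership.Propositional using (_∈_)
open import Data.List.Membership.Propositional.Properties using (∈-allFin; ∈-cartesianProduct⁺)
open import Data.List.Relation.Unary.All using (All; []; _∷_; lookup)
open import Data.List.Relation.Unary.All.Properties using (map⁺; tabulate⁺)
open import Data.List.Relation.Binary.Permutation.Propositional.Properties using (All-resp-↭)
open import Data.Nat.Base
open import Data.Nat.Properties
open import Data.Nat.ListAction using (sum)
open import Data.Product.Base using (Σ; ∃₂; ∃-syntax; _×_; _,_; proj₁; proj₂; uncurry)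
open import Data.Sum.Base using (_⊎_; inj₁; inj₂)
open import Function.Base using (id; _∘_)
open import Function.Bundles using (_⇔_; mk⇔; Equivalence)
open import Level using (0ℓ)
open import Relation.Binary.Core using (Rel; _⇒_; _=[_]⇒_)
open import Relation.Binary.PropositionalEquality
open import Relation.Binary.Construct.Closure.ReflexiveTransitive using (Star; ε; _◅_; _◅◅_)
open import Relation.Nullary.Decidable using (yes; no)
open import Relation.Nullary.Negation using (contradiction)

data Adjacent : Rel ℕ 0ℓ where
  step⁺ : ∀ {x} → Adjacent x (suc x)
  step⁻ : ∀ {x} → Adjacent (suc x) x

Adjacent-+ʳ : ∀ a → Adjacent =[ _+ a ]⇒ Adjacent
Adjacent-+ʳ a step⁺ = step⁺
Adjacent-+ʳ a step⁻ = step⁻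

-- Only growth from a vertical and a horizontal neighbour is recorded; two opposite
-- neighbours would also make a cell mutable, but the proof never needs that rule.
data Spanned (S : Rel ℕ 0ℓ) : Rel ℕ 0ℓ where
  seed : ∀ {x y} → S x y → Spanned S x y
  grow : ∀ {x y x′ y′} → Adjacent x′ x → Spanned S x′ y →
         Adjacent y′ y → Spanned S x y′ → Spanned S x y

Spanned-map : ∀ {S S′ : Rel ℕ 0ℓ} {f g : ℕ → ℕ} →
              Adjacent =[ f ]⇒ Adjacent → Adjacent =[ g ]⇒ Adjacent →
              (∀ {x y} → S x y → S′ (f x) (g y)) →
              ∀ {x y} → Spanned S x y → Spanned S′ (f x) (g y)
Spanned-map f-adj g-adj S→S′ (seed s)           = seed (S→S′ s)
Spanned-map f-adj g-adj S→S′ (grow ax sx ay sy) =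
  grow (f-adj ax) (Spanned-map f-adj g-adj S→S′ sx) (g-adj ay) (Spanned-map f-adj g-adj S→S′ sy)

Spanned-mono : ∀ {S S′ : Rel ℕ 0ℓ} → S ⇒ S′ → Spanned S ⇒ Spanned S′
Spanned-mono = Spanned-map id id

row-seed : ∀ {S x y} → Spanned S x y → ∃[ y′ ] S x y′
row-seed (seed s)        = _ , s
row-seed (grow _ _ _ sy) = row-seed sy

column-seed : ∀ {S x y} → Spanned S x y → ∃[ x′ ] S x′ y
column-seed (seed s)        = _ , s
column-seed (grow _ sx _ _) = column-seed sx

-- Segments are written j + c (j < w) with the offset on the right, so that
-- suc j + c reduces to suc (j + c) and every adjacency below is a constructor.
data Flank : ℕ → ℕ → ℕ → Set where
  before : ∀ {x w} → Flank x (suc x) w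
  after  : ∀ {c w} → Flank (w + c) c w

∀<-extend : ∀ {P : ℕ → Set} {n} → (∀ j → j < n → P j) → P n → ∀ j → j < suc n → P j
∀<-extend below top j j<1+n with m<1+n⇒m<n∨m≡n j<1+n
... | inj₁ j<n  = below j j<n
... | inj₂ refl = top

sweep : ∀ {P : ℕ → Set} {x c w} → Flank x c w → P x →
        (∀ {z} j → j < w → Adjacent z (j + c) → P z → P (j + c)) →
        ∀ j → j < w → P (j + c)
sweep {P} {x} {w = w} before px step = go
  where
  go : ∀ j → j < w → P (j + suc x)
  go zero    j<w = step zero j<w step⁺ px
  go (suc j) j<w = step (suc j) j<w step⁺ (go j (<⇒≤ j<w))
sweep {P} {c = c} {w = suc w} after px step =
  ∀<-extend {λ j → P (j + c)} (sweep after last (λ j j<w → step j (m<n⇒m<1+n j<w))) last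
  where
  last : P (w + c)
  last = step w ≤-refl step⁻ px

Spans : Rel ℕ 0ℓ → ℕ → ℕ → ℕ → ℕ → Set
Spans S r c h w = ∀ i j → i < h → j < w → Spanned S (i + r) (j + c)

span-row : ∀ {S x y z c w} → Adjacent y x → (∀ j → j < w → Spanned S y (j + c)) →
           Flank z c w → Spanned S x z → ∀ j → j < w → Spanned S x (j + c)
span-row ay above flank sz = sweep flank sz (λ j j<w az → grow ay (above j j<w) az)

span-rect : ∀ {S y z r c h w} → Flank y r h → (∀ j → j < w → Spanned S y (j + c)) →
            Flank z c w → (∀ i → i < h → Spanned S (i + r) z) → Spans S r c h w
span-rect {S} {c = c} {w = w} flankʳ above flankᶜ side i j i<h =
  sweep {λ x → ∀ j → j < w → Spanned S x (j + c)} flankʳ above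
        (λ i i<h ay prev → span-row ay prev flankᶜ (side i i<h)) i i<h j

split< : ∀ m {n} i → i < m + n → i < m ⊎ ∃[ k ] k < n × i ≡ k + m
split< zero    i       i<n          = inj₂ (i , i<n , sym (+-identityʳ i))
split< (suc m) zero    _            = inj₁ z<s
split< (suc m) (suc i) (s<s i<m+n) with split< m i i<m+n
... | inj₁ i<m             = inj₁ (s<s i<m)
... | inj₂ (k , k<n , refl) = inj₂ (k , k<n , sym (+-suc k m))

Spans-stack : ∀ {S r c h₁ h₂ w} → Spans S r c h₁ w → Spans S (h₁ + r) c h₂ w →
              Spans S r c (h₁ + h₂) w
Spans-stack {S} {r} {c} {h₁} top bottom i j i<h j<w with split< h₁ i i<h
... | inj₁ i<h₁              = top i j i<h₁ j<w
... | inj₂ (k , k<h₂ , refl) =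
  subst (λ x → Spanned S x (j + c)) (sym (+-assoc k h₁ r)) (bottom k j k<h₂ j<w)

Spans-beside : ∀ {S r c h w₁ w₂} → Spans S r c h w₁ → Spans S r (w₁ + c) h w₂ →
               Spans S r c h (w₁ + w₂)
Spans-beside {S} {r} {c} {w₁ = w₁} left right i j i<h j<w with split< w₁ j j<w
... | inj₁ j<w₁              = left i j i<h j<w₁
... | inj₂ (k , k<w₂ , refl) = subst (Spanned S (i + r)) (sym (+-assoc k w₁ c)) (right i k i<h k<w₂)

Spans-shift : ∀ {S S′ r c h w} a b → (∀ {x y} → S x y → S′ (x + a) (y + b)) →
              Spans S r c h w → Spans S′ (a + r) (b + c) h w
Spans-shift {S′ = S′} {r} {c} a b S→S′ Q i j i<h j<w =
  subst₂ (Spanned S′) (reassoc i r a) (reassoc j c b)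
    (Spanned-map (Adjacent-+ʳ a) (Adjacent-+ʳ b) S→S′ (Q i j i<h j<w))
  where
  reassoc : ∀ i r a → i + r + a ≡ i + (a + r)
  reassoc i r a = trans (+-assoc i r a) (cong (i +_) (+-comm r a))

-- Each of the two remaining rectangles is bordered by an edge row of one square
-- and an edge column of the other.
Spans-merge↘ : ∀ {S} a b s₁ s₂ → Spans S a b s₁ s₁ → Spans S (s₁ + a) (s₁ + b) s₂ s₂ →
               Spans S a b (s₁ + s₂) (s₁ + s₂)
Spans-merge↘     a b zero    s₂ _  Q₂ = Q₂
Spans-merge↘ {S} a b (suc s) s₂ Q₁ Q₂ =
  Spans-stack (Spans-beside Q₁ upperRight) (Spans-beside lowerLeft Q₂)
  where
  upperRight : Spans S a (suc s + b) (suc s) s₂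
  upperRight = span-rect after  (λ j j<s₂ → Q₂ 0 j (m<n⇒0<n j<s₂) j<s₂)
                         before (λ i i<s → Q₁ i s i<s ≤-refl)
  lowerLeft : Spans S (suc s + a) b s₂ (suc s)
  lowerLeft = span-rect before (λ j j<s → Q₁ s j ≤-refl j<s)
                        after  (λ i i<s₂ → Q₂ i 0 i<s₂ (m<n⇒0<n i<s₂))

Spans-merge↗ : ∀ {S} a b s₁ s₂ → Spans S (s₂ + a) b s₁ s₁ → Spans S a (s₁ + b) s₂ s₂ →
               Spans S a b (s₁ + s₂) (s₁ + s₂)
Spans-merge↗ {S} a b s₁ s₂ Q₁ Q₂ =
  subst (λ h → Spans S a b h (s₁ + s₂)) (+-comm s₂ s₁)
    (Spans-stack (Spans-beside upperLeft Q₂) (Spans-beside Q₁ (lowerRight s₁ s₂ Q₁ Q₂)))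
  where
  upperLeft : Spans S a b s₂ s₁
  upperLeft = span-rect after (λ j j<s₁ → Q₁ 0 j (m<n⇒0<n j<s₁) j<s₁)
                       after (λ i i<s₂ → Q₂ i 0 i<s₂ (m<n⇒0<n i<s₂))
  lowerRight : ∀ s₁ s₂ → Spans S (s₂ + a) b s₁ s₁ → Spans S a (s₁ + b) s₂ s₂ →
               Spans S (s₂ + a) (s₁ + b) s₁ s₂
  lowerRight zero    _       _  _  _ _ ()
  lowerRight (suc _) zero    _  _  _ _ _ ()
  lowerRight (suc p) (suc q) Q₁ Q₂ = span-rect before (λ j j<s₂ → Q₂ q j ≤-refl j<s₂)
                                               before (λ i i<s₁ → Q₁ i p i<s₁ ≤-refl)

Ones : ∀ {K} → Matrix K → Rel ℕ 0ℓ
Ones M x y = at M x y ≡ true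

Reach : ∀ {K} → Matrix K → (Matrix K → Set) → Set
Reach {K} M Q = ∃[ M′ ] Star PercStep M M′ × Q M′

at-toℕ : ∀ {K} (M : Matrix K) i j → at M (toℕ i) (toℕ j) ≡ M i j
at-toℕ {K} M i j with toℕ i <? K | toℕ j <? K
... | yes p  | yes q  = cong₂ M (fromℕ<-toℕ i p) (fromℕ<-toℕ j q)
... | no i≮K | _      = contradiction (toℕ<n i) i≮K
... | yes _  | no j≮K = contradiction (toℕ<n j) j≮K

Ones-intro : ∀ {K} {M : Matrix K} {i j} → M i j ≡ true → Ones M (toℕ i) (toℕ j)
Ones-intro {M = M} {i} {j} = trans (at-toℕ M i j)

Ones-elim : ∀ {K} {M : Matrix K} {x y} → Ones M x y →
            ∃₂ λ i j → toℕ i ≡ x × toℕ j ≡ y × M i j ≡ true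
Ones-elim {K} {M} {x} {y} o with x <? K | y <? K
... | yes p | yes q = fromℕ< p , fromℕ< q , toℕ-fromℕ< p , toℕ-fromℕ< q , o

Ones-cong : ∀ {K} {M M′ : Matrix K} → (∀ i j → M i j ≡ M′ i j) → Ones M ⇒ Ones M′
Ones-cong {M = M} {M′} M≗M′ o with Ones-elim {M = M} o
... | i , j , refl , refl , m = Ones-intro {M = M′} (trans (sym (M≗M′ i j)) m)

PercStep-mono : ∀ {K} {M M′ : Matrix K} → PercStep M M′ → ∀ {i j} → M i j ≡ true → M′ i j ≡ true
PercStep-mono (i , j , _ , M′≡) {i′} {j′} m rewrite M′≡ i′ j′
  with (toℕ i′ ≡ᵇ toℕ i) ∧ (toℕ j′ ≡ᵇ toℕ j)
... | true  = refl
... | false = m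

Star-mono : ∀ {K} {M M′ : Matrix K} → Star PercStep M M′ → ∀ {i j} → M i j ≡ true → M′ i j ≡ true
Star-mono ε              m = m
Star-mono (step ◅ steps) m = Star-mono steps (PercStep-mono step m)

Ones-mono : ∀ {K} {M M′ : Matrix K} → Star PercStep M M′ → Ones M ⇒ Ones M′
Ones-mono {M = M} {M′} steps o with Ones-elim {M = M} o
... | _ , _ , refl , refl , m = Ones-intro {M = M′} (Star-mono steps m)

adjacentOnes : (ℕ → Bool) → ℕ → ℕ
adjacentOnes f zero    = b2n (f 1)
adjacentOnes f (suc x) = b2n (f x) + b2n (f (suc (suc x)))

adjacentOnes-pos : ∀ {f x x′} → Adjacent x′ x → f x′ ≡ true → 1 ≤ adjacentOnes f x
adjacentOnes-pos             step⁺ fx′ rewrite fx′ = s≤s z≤n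
adjacentOnes-pos {x = zero}  step⁻ fx′ rewrite fx′ = ≤-refl
adjacentOnes-pos {x = suc x} step⁻ fx′ rewrite fx′ = m≤n+m 1 _

-- Splitting i and j lets the local north/west helpers of neighbours1 reduce.
neighbours1≡ : ∀ {K} (M : Matrix K) i j →
  neighbours1 M i j ≡ adjacentOnes (λ x → at M x (toℕ j)) (toℕ i) + adjacentOnes (at M (toℕ i)) (toℕ j)
neighbours1≡ M zero    zero    = cong (_+ b2n (at M 0 1)) (+-identityʳ (adjacentOnes (λ x → at M x 0) 0))
neighbours1≡ M zero    (suc j) = +-assoc (adjacentOnes (λ x → at M x (suc (toℕ j))) 0)
                                         (b2n (at M 0 (toℕ j))) (b2n (at M 0 (suc (suc (toℕ j)))))
neighbours1≡ M (suc i) zero    = cong (_+ b2n (at M (suc (toℕ i)) 1))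
                                      (+-identityʳ (adjacentOnes (λ x → at M x 0) (suc (toℕ i))))
neighbours1≡ M (suc i) (suc j) = +-assoc (adjacentOnes (λ x → at M x (suc (toℕ j))) (suc (toℕ i)))
                                         (b2n (at M (suc (toℕ i)) (toℕ j)))
                                         (b2n (at M (suc (toℕ i)) (suc (suc (toℕ j)))))

mutate : ∀ {K} (M : Matrix K) i j → 2 ≤ neighbours1 M i j → Reach M (λ M′ → M′ i j ≡ true)
mutate M i j two with M i j in mij
... | true  = M , ε , mij
... | false = M′ , (i , j , (mij , two) , λ _ _ → refl) ◅ ε , hit
  where
  M′ : Matrix _
  M′ i′ j′ = if (toℕ i′ ≡ᵇ toℕ i) ∧ (toℕ j′ ≡ᵇ toℕ j) then true else M i′ j′
  hit : M′ i j ≡ true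
  hit rewrite Equivalence.to T-≡ (≡⇒≡ᵇ (toℕ i) (toℕ i) refl)
            | Equivalence.to T-≡ (≡⇒≡ᵇ (toℕ j) (toℕ j) refl) = refl

mutate-adjacent : ∀ {K} {M : Matrix K} {x y x′ y′} →
                  Adjacent x′ x → Ones M x′ y → Adjacent y′ y → Ones M x y′ →
                  Reach M (λ M′ → Ones M′ x y)
mutate-adjacent {M = M} ax vx ay hy with Ones-elim {M = M} hy | Ones-elim {M = M} vx
... | i , _ , refl , _ , _ | _ , j , _ , refl , _ with mutate M i j two
  where
  two : 2 ≤ neighbours1 M i j
  two = subst (2 ≤_) (sym (neighbours1≡ M i j))
          (+-mono-≤ (adjacentOnes-pos {λ x → at M x (toℕ j)} ax vx) (adjacentOnes-pos {at M (toℕ i)} ay hy))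
... | M′ , steps , m = M′ , steps , Ones-intro {M = M′} m

Spanned⇒Reach : ∀ {K S} {M : Matrix K} → S ⇒ Ones M →
                ∀ {x y} → Spanned S x y → Reach M (λ M′ → Ones M′ x y)
Spanned⇒Reach S⊆M (seed s)           = _ , ε , S⊆M s
Spanned⇒Reach S⊆M (grow ax sx ay sy) with Spanned⇒Reach S⊆M sx
... | M₁ , M→M₁ , o₁ with Spanned⇒Reach (λ s → Ones-mono M→M₁ (S⊆M s)) sy
... | M₂ , M₁→M₂ , o₂ with mutate-adjacent ax (Ones-mono M₁→M₂ o₁) ay o₂
... | M₃ , M₂→M₃ , o₃ = M₃ , M→M₁ ◅◅ M₁→M₂ ◅◅ M₂→M₃ , o₃

Spanning : ∀ {K} → Matrix K → Set
Spanning {K} M = ∀ (i j : Fin K) → Spanned (Ones M) (toℕ i) (toℕ j)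

Spanned⇒Reach-all : ∀ {K S} {M : Matrix K} → S ⇒ Ones M →
                    (∀ (i j : Fin K) → Spanned S (toℕ i) (toℕ j)) →
                    (cs : List (Fin K × Fin K)) → Reach M (λ M′ → All (uncurry λ i j → M′ i j ≡ true) cs)
Spanned⇒Reach-all S⊆M spanned []             = _ , ε , []
Spanned⇒Reach-all S⊆M spanned ((i , j) ∷ cs) with Spanned⇒Reach S⊆M (spanned i j)
... | M₁ , M→M₁ , o₁ with Spanned⇒Reach-all (λ s → Ones-mono M→M₁ (S⊆M s)) spanned cs
... | M₂ , M₁→M₂ , all₂ =
  M₂ , M→M₁ ◅◅ M₁→M₂ , Star-mono M₁→M₂ (trans (sym (at-toℕ M₁ i j)) o₁) ∷ all₂

Spanning⇒fills : ∀ {K} {M : Matrix K} → Spanning M → Reach M (λ M′ → ∀ i j → M′ i j ≡ true)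
Spanning⇒fills {K} spanned with Spanned⇒Reach-all id spanned (cartesianProduct (allFin K) (allFin K))
... | M′ , steps , ones =
  M′ , steps , λ i j → lookup ones (∈-cartesianProduct⁺ (∈-allFin i) (∈-allFin j))

Spanning-cong : ∀ {K} {M M′ : Matrix K} → (∀ i j → M i j ≡ M′ i j) → Spanning M → Spanning M′
Spanning-cong M≗M′ spanned i j = Spanned-mono (Ones-cong M≗M′) (spanned i j)

Spanning⇒rowOne : ∀ {K} {M : Matrix K} → Spanning M → ∀ i → ∃[ j ] M i j ≡ true
Spanning⇒rowOne {M = M} spanned i with Ones-elim {M = M} (proj₂ (row-seed (spanned i i)))
... | _ , j , i′≡i , _ , m = j , subst (λ i → M i j ≡ true) (toℕ-injective i′≡i) m

Spanning⇒columnOne : ∀ {K} {M : Matrix K} → Spanning M → ∀ j → ∃[ i ] M i j ≡ true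
Spanning⇒columnOne {M = M} spanned j with Ones-elim {M = M} (proj₂ (column-seed (spanned j j)))
... | i , _ , _ , j′≡j , m = i , subst (λ j → M i j ≡ true) (toℕ-injective j′≡j) m

m+n+1≡m+[1+n] : ∀ m n → m + n + 1 ≡ m + suc n
m+n+1≡m+[1+n] m n = trans (+-assoc m n 1) (cong (m +_) (+-comm n 1))

permMatrix-true : ∀ {k} (σ : Permutation′ k) x y → permMatrix σ x y ≡ true ⇔ x ≡ opposite (σ ⟨$⟩ʳ y)
permMatrix-true {k} σ x y = mk⇔ to from
  where
  v = toℕ (σ ⟨$⟩ʳ y)
  to : permMatrix σ x y ≡ true → x ≡ opposite (σ ⟨$⟩ʳ y)
  to e = toℕ-injective (begin
    toℕ x                     ≡⟨ sym (m+n∸n≡m (toℕ x) (suc v)) ⟩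
    toℕ x + suc v ∸ suc v     ≡⟨ cong (_∸ suc v) (trans (sym (m+n+1≡m+[1+n] (toℕ x) v))
                                                        (≡ᵇ⇒≡ _ k (Equivalence.from T-≡ e))) ⟩
    k ∸ suc v                 ≡⟨ opposite-prop (σ ⟨$⟩ʳ y) ⟨
    toℕ (opposite (σ ⟨$⟩ʳ y)) ∎)
    where open ≡-Reasoning
  from : x ≡ opposite (σ ⟨$⟩ʳ y) → permMatrix σ x y ≡ true
  from refl = Equivalence.to T-≡ (≡⇒≡ᵇ _ k (begin
    toℕ (opposite (σ ⟨$⟩ʳ y)) + v + 1     ≡⟨ m+n+1≡m+[1+n] _ v ⟩
    toℕ (opposite (σ ⟨$⟩ʳ y)) + suc v     ≡⟨ cong (_+ suc v) (opposite-prop (σ ⟨$⟩ʳ y)) ⟩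
    k ∸ suc v + suc v                     ≡⟨ m∸n+n≡m (toℕ<n (σ ⟨$⟩ʳ y)) ⟩
    k                                     ∎))
    where open ≡-Reasoning

permMatrix-row : ∀ {k} (σ : Permutation′ k) {x y} → permMatrix σ x y ≡ true → y ≡ σ ⟨$⟩ˡ opposite x
permMatrix-row σ {x} {y} e = begin
  y                                     ≡⟨ inverseˡ σ ⟨
  σ ⟨$⟩ˡ (σ ⟨$⟩ʳ y)                     ≡⟨ cong (σ ⟨$⟩ˡ_) (opposite-involutive (σ ⟨$⟩ʳ y)) ⟨
  σ ⟨$⟩ˡ opposite (opposite (σ ⟨$⟩ʳ y)) ≡⟨ cong ((σ ⟨$⟩ˡ_) ∘ opposite) x≡ ⟨
  σ ⟨$⟩ˡ opposite x                     ∎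
  where
  open ≡-Reasoning
  x≡ = Equivalence.to (permMatrix-true σ x y) e

permMatrix-rowUnique : ∀ {k} (σ : Permutation′ k) {x y y′} →
  Ones (permMatrix σ) x y → Ones (permMatrix σ) x y′ → y ≡ y′
permMatrix-rowUnique σ o o′ with Ones-elim {M = permMatrix σ} o | Ones-elim {M = permMatrix σ} o′
... | i , j , refl , refl , m | i′ , j′ , i′≡i , refl , m′ with toℕ-injective i′≡i
... | refl = cong toℕ (trans (permMatrix-row σ {i} m) (sym (permMatrix-row σ {i} m′)))

permMatrix-columnUnique : ∀ {k} (σ : Permutation′ k) {x x′ y} →
  Ones (permMatrix σ) x y → Ones (permMatrix σ) x′ y → x ≡ x′
permMatrix-columnUnique σ o o′ with Ones-elim {M = permMatrix σ} o | Ones-elim {M = permMatrix σ} o′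
... | i , j , refl , refl , m | i′ , j′ , refl , j′≡j , m′ with toℕ-injective j′≡j
... | refl = cong toℕ (trans (Equivalence.to (permMatrix-true σ i j) m)
                             (sym (Equivalence.to (permMatrix-true σ i′ j) m′)))

record IsPermutationMatrix {k} (M : Matrix k) : Set where
  field
    rowOne       : ∀ i → ∃[ j ] M i j ≡ true
    columnOne    : ∀ j → ∃[ i ] M i j ≡ true
    rowUnique    : ∀ {i j j′} → M i j ≡ true → M i j′ ≡ true → j ≡ j′
    columnUnique : ∀ {i i′ j} → M i j ≡ true → M i′ j ≡ true → i ≡ i′

IsPermutationMatrix⇒permMatrix : ∀ {k} {M : Matrix k} → IsPermutationMatrix M →
  Σ (Permutation′ k) λ σ → ∀ i j → permMatrix σ i j ≡ M i j
IsPermutationMatrix⇒permMatrix {k} {M} isPM = σ , λ i j → ⇔→≡ (mk⇔ (to i j) (from i j))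
  where
  open IsPermutationMatrix isPM
  rowOf : Fin k → Fin k
  rowOf j = proj₁ (columnOne j)
  columnOf : Fin k → Fin k
  columnOf i = proj₁ (rowOne i)
  -- permMatrix σ has the one of column j in row opposite (σ j).
  σ : Permutation′ k
  σ = permutation (opposite ∘ rowOf) (columnOf ∘ opposite)
        (λ v → trans (cong opposite (columnUnique (proj₂ (columnOne _)) (proj₂ (rowOne (opposite v)))))
                     (opposite-involutive v))
        (λ j → trans (cong columnOf (opposite-involutive (rowOf j)))
                     (rowUnique (proj₂ (rowOne (rowOf j))) (proj₂ (columnOne j))))
  to : ∀ i j → permMatrix σ i j ≡ true → M i j ≡ true
  to i j e = subst (λ i → M i j ≡ true)
               (sym (trans (Equivalence.to (permMatrix-true σ i j) e) (opposite-involutive (rowOf j))))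
               (proj₂ (columnOne j))
  from : ∀ i j → M i j ≡ true → permMatrix σ i j ≡ true
  from i j m = Equivalence.from (permMatrix-true σ i j)
                 (trans (columnUnique m (proj₂ (columnOne j))) (sym (opposite-involutive (rowOf j))))

map-tabulate-suc : ∀ {A : Set} {k} (h : Fin (suc k) → A) → map h (tabulate suc) ≡ map (h ∘ suc) (allFin k)
map-tabulate-suc h = trans (map-tabulate suc h) (sym (map-tabulate id (h ∘ suc)))

sum-const : ∀ {k c} (h : Fin k → ℕ) → (∀ i → h i ≡ c) → sum (map h (allFin k)) ≡ k * c
sum-const {zero}  h h≡c = refl
sum-const {suc k} h h≡c rewrite map-tabulate-suc h = cong₂ _+_ (h≡c zero) (sum-const (h ∘ suc) (h≡c ∘ suc))

sum-indicator : ∀ {k} (v : Fin k → Bool) {i} → v i ≡ true → (∀ {j} → v j ≡ true → i ≡ j) →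
                sum (map (b2n ∘ v) (allFin k)) ≡ 1
sum-indicator {suc k} v {zero} vi unique rewrite map-tabulate-suc (b2n ∘ v) | vi =
  cong suc (trans (sum-const (b2n ∘ v ∘ suc) (λ j → cong b2n (¬-not (Finₚ.0≢1+n ∘ unique))))
                  (*-zeroʳ k))
sum-indicator {suc k} v {suc i} vi unique
  rewrite map-tabulate-suc (b2n ∘ v) | ¬-not {v zero} (Finₚ.0≢1+n ∘ sym ∘ unique) =
  sum-indicator (v ∘ suc) vi (Finₚ.suc-injective ∘ unique)

IsPermutationMatrix⇒countOnes : ∀ {k} {M : Matrix k} → IsPermutationMatrix M → countOnes M ≡ k
IsPermutationMatrix⇒countOnes {k} {M} isPM =
  trans (sum-const _ (λ i → sum-indicator (M i) (proj₂ (rowOne i)) (rowUnique (proj₂ (rowOne i)))))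
        (*-identityʳ k)
  where open IsPermutationMatrix isPM

module _ {n} (π : Permutation′ n) where

  Pattern : Tile → Rel ℕ 0ℓ
  Pattern T x y = x < size T × y < size T × Ones (permMatrix π) (row T + x) (col T + y)

  Percolates : Tile → Set
  Percolates T = Spans (Pattern T) 0 0 (size T) (size T)

  Pattern-embed : ∀ {T T′ a b} → a + size T′ ≤ size T → b + size T′ ≤ size T →
    row T′ ≡ row T + a → col T′ ≡ col T + b → ∀ {x y} → Pattern T′ x y → Pattern T (x + a) (y + b)
  Pattern-embed {T} {T′} a+s′≤s b+s′≤s row≡ col≡ (x<s′ , y<s′ , o) =
    shift< a+s′≤s x<s′ , shift< b+s′≤s y<s′ ,
    subst₂ (Ones (permMatrix π)) (shift≡ (row T) row≡) (shift≡ (col T) col≡) o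
    where
    shift< : ∀ {a x} → a + size T′ ≤ size T → x < size T′ → x + a < size T
    shift< {a} {x} a+s′≤s x<s′ =
      <-≤-trans (subst (x + a <_) (+-comm (size T′) a) (+-monoˡ-< a x<s′)) a+s′≤s
    shift≡ : ∀ r {r′ a x} → r′ ≡ r + a → r′ + x ≡ r + (x + a)
    shift≡ r {a = a} {x} refl = trans (+-assoc r a x) (cong (r +_) (+-comm a x))

  merge↘-percolates : ∀ {r c s₁ s₂} →
    Percolates (tile r c s₁) → Percolates (tile (r + s₁) (c + s₁) s₂) → Percolates (tile r c (s₁ + s₂))
  merge↘-percolates {r} {c} {s₁} {s₂} P₁ P₂ = Spans-merge↘ 0 0 s₁ s₂
    (Spans-shift 0 0
      (Pattern-embed {T} (m≤m+n s₁ s₂) (m≤m+n s₁ s₂) (sym (+-identityʳ r)) (sym (+-identityʳ c))) P₁)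
    (Spans-shift s₁ s₁ (Pattern-embed {T} ≤-refl ≤-refl refl refl) P₂)
    where T = tile r c (s₁ + s₂)

  merge↗-percolates : ∀ {r c s₁ s₂} →
    Percolates (tile (r + s₂) c s₁) → Percolates (tile r (c + s₁) s₂) → Percolates (tile r c (s₁ + s₂))
  merge↗-percolates {r} {c} {s₁} {s₂} P₁ P₂ = Spans-merge↗ 0 0 s₁ s₂
    (Spans-shift s₂ 0
      (Pattern-embed {T} (≤-reflexive (+-comm s₂ s₁)) (m≤m+n s₁ s₂) refl (sym (+-identityʳ c))) P₁)
    (Spans-shift 0 s₁
      (Pattern-embed {T} (m≤n+m s₂ s₁) ≤-refl (sym (+-identityʳ r)) refl) P₂)
    where T = tile r c (s₁ + s₂)

  merge-percolates : ∀ T₁ T₂ → DiagAdj T₁ T₂ →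
                     Percolates T₁ → Percolates T₂ → Percolates (merge T₁ T₂)
  merge-percolates (tile r c s₁) (tile _ _ s₂) (refl , inj₁ refl)
    rewrite m≤n⇒m⊓n≡m (m≤m+n r s₁) | m≤n⇒m⊓n≡m (m≤m+n c s₁) =
    merge↘-percolates {r} {c} {s₁} {s₂}
  merge-percolates (tile _ c s₁) (tile r _ s₂) (refl , inj₂ refl)
    rewrite m≥n⇒m⊓n≡n (m≤m+n r s₂) | m≤n⇒m⊓n≡m (m≤m+n c s₁) =
    merge↗-percolates {r} {c} {s₁} {s₂}

  merging-preserves-percolation : ∀ {ts ts′} →
    All Percolates ts → Star MergeStep ts ts′ → All Percolates ts′
  merging-preserves-percolation Ps ε = Ps
  merging-preserves-percolation Ps ((T₁ , T₂ , _ , ts↭ , adj , refl) ◅ steps) with All-resp-↭ ts↭ Ps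
  ... | P₁ ∷ P₂ ∷ Ps′ =
    merging-preserves-percolation (merge-percolates T₁ T₂ adj P₁ P₂ ∷ Ps′) steps

  Pattern⇒Ones : ∀ {T} → Pattern T ⇒ Ones (subMatrix π T)
  Pattern⇒Ones {T} (x<s , y<s , o) =
    subst₂ (Ones (subMatrix π T)) (toℕ-fromℕ< x<s) (toℕ-fromℕ< y<s)
      (Ones-intro {M = subMatrix π T}
        (subst₂ (λ x y → Ones (permMatrix π) (row T + x) (col T + y))
                (sym (toℕ-fromℕ< x<s)) (sym (toℕ-fromℕ< y<s)) o))

  Percolates⇒Spanning : ∀ {T} → Percolates T → Spanning (subMatrix π T)
  Percolates⇒Spanning {T} perc i j = Spanned-mono (Pattern⇒Ones {T})
    (subst₂ (Spanned (Pattern T)) (+-identityʳ _) (+-identityʳ _)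
            (perc (toℕ i) (toℕ j) (toℕ<n i) (toℕ<n j)))

  Spanning⇒subMatrix-isPermutationMatrix : ∀ T → Spanning (subMatrix π T) →
                                           IsPermutationMatrix (subMatrix π T)
  Spanning⇒subMatrix-isPermutationMatrix T spanning = record
    { rowOne       = Spanning⇒rowOne spanning
    ; columnOne    = Spanning⇒columnOne spanning
    ; rowUnique    = λ m m′ → toℕ-injective (+-cancelˡ-≡ (col T) _ _ (permMatrix-rowUnique π m m′))
    ; columnUnique = λ m m′ → toℕ-injective (+-cancelˡ-≡ (row T) _ _ (permMatrix-columnUnique π m m′))
    }

  Percolates⇒Good : ∀ T → Percolates T → Good π T
  Percolates⇒Good T perc =
    IsPermutationMatrix⇒countOnes isPM , σ , σ≗ ,
    Spanning⇒fills {M = permMatrix σ} (Spanning-cong (λ i j → sym (σ≗ i j)) spanning)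
    where
    spanning = Percolates⇒Spanning {T} perc
    isPM = Spanning⇒subMatrix-isPermutationMatrix T spanning
    σ = proj₁ (IsPermutationMatrix⇒permMatrix isPM)
    σ≗ = proj₂ (IsPermutationMatrix⇒permMatrix isPM)

initialTile-percolates : ∀ {n} (π : Permutation′ n) j → Percolates π (initialTile π j)
initialTile-percolates {suc n} π j zero    zero    _       _        =
  seed (z<s , z<s , subst₂ (Ones (permMatrix π)) row≡ (sym (+-identityʳ (toℕ j))) one)
  where
  one : Ones (permMatrix π) (toℕ (opposite (π ⟨$⟩ʳ j))) (toℕ j)
  one = Ones-intro {M = permMatrix π} {opposite (π ⟨$⟩ʳ j)} {j}
          (Equivalence.from (permMatrix-true π (opposite (π ⟨$⟩ʳ j)) j) refl)
  row≡ : toℕ (opposite (π ⟨$⟩ʳ j)) ≡ n ∸ toℕ (π ⟨$⟩ʳ j) + 0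
  row≡ = trans (opposite-prop (π ⟨$⟩ʳ j)) (sym (+-identityʳ _))
initialTile-percolates {suc n} π j zero    (suc _) _       (s<s ())
initialTile-percolates {suc n} π j (suc _) _       (s<s ()) _

initialTiles-percolate : ∀ {n} (π : Permutation′ n) → All (Percolates π) (initialTiles π)
initialTiles-percolate {zero}  π = []
initialTiles-percolate {suc n} π = map⁺ (tabulate⁺ (initialTile-percolates π))

lemma2p19 : (n : ℕ) (π : Permutation′ n) (ts : List Tile) (T : Tile) →
    Star MergeStep (initialTiles π) ts → T ∈ ts → Good π T
lemma2p19 n π ts T steps T∈ts =
  Percolates⇒Good π T (lookup (merging-preserves-percolation π (initialTiles-percolate π) steps) T∈ts)
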